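{- A Motzkin N-walk is of type II if and only if it is constructed only from the N-steps $\{ -1\}$, $\{0\}$, $\{1\}$, and $\{ -1,1\}$. Otherwise, it is of type I.
   Context: An N-step is a non-empty finite set of integers. Motzkin N-walks are finite sequences $w=(s_1,\dots,s_n)$ of N-steps from $\{\{ -1\},\{0\},\{1\},\{ -1,0\},\{ -1,1\},\{0,1\},\{ -1,0,1\}\}$, starting at $0$ (the empty sequence is allowed). The reachable points $\operatorname{reach}(w)$ are the endpoints $v_1+\cdots+v_n$ of all integer sequences with $v_i\in s_i$ (for the empty walk, $\{0\}$); $\min(w),\max(w)$ are their minimum and maximum and $\|w\|=\max(w)-\min(w)$. $w$ is of type I if $\operatorname{reach}(w)=\{\min(w)+i:i=0,1,\dots,\|w\|\}$ and $\|w\|\ge1$; of type II if $\operatorname{reach}(w)=\{\min(w)+2i: i=0,1,\dots,\|w\|/2\}$. -}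

module Defs where

open import Data.Nat using (ℕ; _/_) renaming (_≤_ to _≤ℕ_; _*_ to _*ℕ_)
open import Data.Integer using (ℤ; +_; -_; _+_; _-_; _≤_; ∣_∣)
open import Data.List using (List; []; _∷_)
open import Data.List.Membership.Propositional using (_∈_)
open import Data.Product using (Σ; ∃; ∃-syntax; _×_)
open import Function.Bundles using (_⇔_)
open import Relation.Binary.PropositionalEquality using (_≡_)

data NStep : Set where
  m1 z0 p1 m1z0 m1p1 z0p1 m1z0p1 : NStep

stepSet : NStep → List ℤ
stepSet m1     = - + 1 ∷ []
stepSet z0     = + 0 ∷ []
stepSet p1     = + 1 ∷ []
stepSet m1z0   = - + 1 ∷ + 0 ∷ []
stepSet m1p1   = - + 1 ∷ + 1 ∷ []
stepSet z0p1   = + 0 ∷ + 1 ∷ []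
stepSet m1z0p1 = - + 1 ∷ + 0 ∷ + 1 ∷ []

Walk : Set
Walk = List NStep

data Reach : Walk → ℤ → Set where
  reach-[] : Reach [] (+ 0)
  reach-∷  : ∀ {s w v z} → v ∈ stepSet s → Reach w z → Reach (s ∷ w) (v + z)

IsMin : Walk → ℤ → Set
IsMin w m = Reach w m × (∀ z → Reach w z → m ≤ z)

IsMax : Walk → ℤ → Set
IsMax w M = Reach w M × (∀ z → Reach w z → z ≤ M)

TypeI : Walk → Set
TypeI w = ∃[ m ] ∃[ M ] (IsMin w m × IsMax w M ×
  (∀ z → Reach w z ⇔ (∃[ i ] (i ≤ℕ ∣ M - m ∣ × z ≡ m + + i))) ×
  (+ 1 ≤ M - m))

TypeII : Walk → Set
TypeII w = ∃[ m ] ∃[ M ] (IsMin w m × IsMax w M ×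
  (∀ z → Reach w z ⇔ (∃[ i ] (i ≤ℕ ∣ M - m ∣ / 2 × z ≡ m + + (2 *ℕ i)))))

typeIISteps : List NStep
typeIISteps = m1 ∷ z0 ∷ p1 ∷ m1p1 ∷ []

-- The reachable set of a walk is the Minkowski sum of the step sets, so it is
-- determined by its minimum together with a "profile" of offsets, which is
-- either an arithmetic progression {0, 2, …, 2h} or an interval {0, …, n + 1}.
-- The steps {-1}, {0}, {1}, {-1,1} have progression profiles and the other
-- three have interval profiles. A sum of two progressions is a progression,
-- while a sum involving an interval is an interval; so the reachable set is a
-- progression exactly when every step is one of the four, and an interval
-- (hence of type I and, containing min + 1, not of type II) otherwise.
module Submission where

open import Defs
import Data.Integer.Properties as ℤ
open import Algebra.Properties.AbelianGroup ℤ.+-0-abelianGroup using (xyx⁻¹≈y; ∙-cancelˡ)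
open import Algebra.Properties.CommutativeSemigroup ℤ.+-commutativeSemigroup using (interchange)
open import Data.Empty using (⊥; ⊥-elim)
open import Data.Integer using (ℤ; +_; -_; _+_; _-_; _≤_; ∣_∣; +≤+)
open import Data.List using ([]; _∷_)
open import Data.List.Membership.Propositional using (_∈_)
open import Data.List.Relation.Unary.All using (All; []; _∷_)
open import Data.List.Relation.Unary.Any using (here; there)
open import Data.Nat as ℕ using (ℕ; zero; suc; z≤n; s≤s; s≤s⁻¹)
open import Data.Nat.DivMod using (m*n/n≡m)
import Data.Nat.Properties as ℕ
open import Data.Product using (_×_; _,_; ∃-syntax)
open import Data.Unit using (⊤; tt)
open import Function using (_∘_; const)
open import Function.Bundles using (_⇔_; mk⇔; Equivalence)
open import Relation.Binary.PropositionalEquality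
  using (_≡_; _≢_; refl; sym; trans; cong; subst)
open import Relation.Nullary using (¬_; yes; no; contradiction)

open Equivalence using (to; from)

≤-+-split : ∀ a b {k} → k ℕ.≤ a ℕ.+ b →
  ∃[ x ] ∃[ y ] (x ℕ.≤ a × y ℕ.≤ b × k ≡ x ℕ.+ y)
≤-+-split zero    b {k}     k≤b       = 0 , k , z≤n , k≤b , refl
≤-+-split (suc a) b {zero}  _         = 0 , 0 , z≤n , z≤n , refl
≤-+-split (suc a) b {suc k} (s≤s k≤) with ≤-+-split a b k≤
... | x , y , x≤a , y≤b , refl = suc x , y , s≤s x≤a , y≤b , refl

≤-2*+-split : ∀ a b {k} → k ℕ.≤ 2 ℕ.* a ℕ.+ suc b →
  ∃[ i ] ∃[ y ] (i ℕ.≤ a × y ℕ.≤ suc b × k ≡ 2 ℕ.* i ℕ.+ y)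
≤-2*+-split zero    b {k} k≤ = 0 , k , z≤n , k≤ , refl
≤-2*+-split (suc a) b {k} k≤ with k ℕ.≤? suc b
... | yes k≤1+b = 0 , k , z≤n , k≤1+b , refl
≤-2*+-split (suc a) b {zero}          _  | no k≰1+b = contradiction z≤n k≰1+b
≤-2*+-split (suc a) b {suc zero}      _  | no k≰1+b = contradiction (s≤s z≤n) k≰1+b
≤-2*+-split (suc a) b {suc (suc k)}   k≤ | no _
  with ≤-2*+-split a b (s≤s⁻¹ (s≤s⁻¹ (subst (suc (suc k) ℕ.≤_) 2*[1+a]+[1+b] k≤)))
  where
  2*[1+a]+[1+b] : 2 ℕ.* suc a ℕ.+ suc b ≡ 2 ℕ.+ (2 ℕ.* a ℕ.+ suc b)
  2*[1+a]+[1+b] = cong (ℕ._+ suc b) (ℕ.*-suc 2 a)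
... | i , y , i≤a , y≤1+b , refl =
  suc i , y , s≤s i≤a , y≤1+b , cong (ℕ._+ y) (sym (ℕ.*-suc 2 i))

2*i≢1 : ∀ i → 2 ℕ.* i ≢ 1
2*i≢1 zero          ()
2*i≢1 (suc zero)    ()
2*i≢1 (suc (suc i)) ()

-- evens h = {0, 2, …, 2h} and interval n = {0, 1, …, n + 1}; an interval
-- always has at least two points.
data Profile : Set where
  evens interval : ℕ → Profile

infix 4 _∈ₚ_
_∈ₚ_ : ℕ → Profile → Set
x ∈ₚ evens h    = ∃[ i ] (i ℕ.≤ h × x ≡ 2 ℕ.* i)
x ∈ₚ interval n = x ℕ.≤ suc n

top : Profile → ℕ
top (evens h)    = 2 ℕ.* h
top (interval n) = suc n

0∈ₚ : ∀ P → 0 ∈ₚ P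
0∈ₚ (evens h)    = 0 , z≤n , refl
0∈ₚ (interval n) = z≤n

top∈ₚ : ∀ P → top P ∈ₚ P
top∈ₚ (evens h)    = h , ℕ.≤-refl , refl
top∈ₚ (interval n) = ℕ.≤-refl

∈ₚ⇒≤top : ∀ P {x} → x ∈ₚ P → x ℕ.≤ top P
∈ₚ⇒≤top (evens h)    (i , i≤h , refl) = ℕ.*-monoʳ-≤ 2 i≤h
∈ₚ⇒≤top (interval n) x≤1+n            = x≤1+n

-- The mixed cases are written so that interval a ⊕ evens b = evens b ⊕ interval a
-- holds definitionally.
infixl 6 _⊕_
_⊕_ : Profile → Profile → Profile
evens a    ⊕ evens b    = evens (a ℕ.+ b)
evens a    ⊕ interval b = interval (2 ℕ.* a ℕ.+ b)
interval a ⊕ evens b    = interval (2 ℕ.* b ℕ.+ a)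
interval a ⊕ interval b = interval (suc (a ℕ.+ b))

∈ₚ-evens⊕interval : ∀ a b {x y} → x ∈ₚ evens a → y ∈ₚ interval b →
  x ℕ.+ y ∈ₚ evens a ⊕ interval b
∈ₚ-evens⊕interval a b {y = y} (i , i≤a , refl) y≤1+b =
  subst (2 ℕ.* i ℕ.+ y ℕ.≤_) (ℕ.+-suc (2 ℕ.* a) b)
    (ℕ.+-mono-≤ (ℕ.*-monoʳ-≤ 2 i≤a) y≤1+b)

∈ₚ-evens⊕interval⁻ : ∀ a b {k} → k ∈ₚ evens a ⊕ interval b →
  ∃[ x ] ∃[ y ] (x ∈ₚ evens a × y ∈ₚ interval b × k ≡ x ℕ.+ y)
∈ₚ-evens⊕interval⁻ a b {k} k≤
  with ≤-2*+-split a b {k} (subst (k ℕ.≤_) (sym (ℕ.+-suc (2 ℕ.* a) b)) k≤)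
... | i , y , i≤a , y≤1+b , refl = 2 ℕ.* i , y , (i , i≤a , refl) , y≤1+b , refl

∈ₚ-⊕ : ∀ P Q {x y} → x ∈ₚ P → y ∈ₚ Q → x ℕ.+ y ∈ₚ P ⊕ Q
∈ₚ-⊕ (evens a) (evens b) (i , i≤a , refl) (j , j≤b , refl) =
  i ℕ.+ j , ℕ.+-mono-≤ i≤a j≤b , sym (ℕ.*-distribˡ-+ 2 i j)
∈ₚ-⊕ (evens a)    (interval b) x∈ y∈ = ∈ₚ-evens⊕interval a b x∈ y∈
∈ₚ-⊕ (interval a) (evens b) {x} {y} x∈ y∈ =
  subst (_∈ₚ interval a ⊕ evens b) (ℕ.+-comm y x) (∈ₚ-evens⊕interval b a y∈ x∈)
∈ₚ-⊕ (interval a) (interval b) {x} {y} x≤1+a y≤1+b =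
  subst (x ℕ.+ y ℕ.≤_) (cong suc (ℕ.+-suc a b)) (ℕ.+-mono-≤ x≤1+a y≤1+b)

∈ₚ-⊕⁻ : ∀ P Q {k} → k ∈ₚ P ⊕ Q →
  ∃[ x ] ∃[ y ] (x ∈ₚ P × y ∈ₚ Q × k ≡ x ℕ.+ y)
∈ₚ-⊕⁻ (evens a) (evens b) (i , i≤a+b , refl) with ≤-+-split a b i≤a+b
... | j , l , j≤a , l≤b , refl =
  2 ℕ.* j , 2 ℕ.* l , (j , j≤a , refl) , (l , l≤b , refl) , ℕ.*-distribˡ-+ 2 j l
∈ₚ-⊕⁻ (evens a)    (interval b) k∈ = ∈ₚ-evens⊕interval⁻ a b k∈
∈ₚ-⊕⁻ (interval a) (evens b)    k∈ with ∈ₚ-evens⊕interval⁻ b a k∈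
... | x , y , x∈ , y∈ , refl = y , x , y∈ , x∈ , ℕ.+-comm x y
∈ₚ-⊕⁻ (interval a) (interval b) {k} k≤ =
  ≤-+-split (suc a) (suc b) (subst (k ℕ.≤_) (sym (cong suc (ℕ.+-suc a b))) k≤)

infix 4 _∈[_+ₚ_]
_∈[_+ₚ_] : ℤ → ℤ → Profile → Set
z ∈[ lo +ₚ P ] = ∃[ x ] (x ∈ₚ P × z ≡ lo + + x)

∈[+ₚ]-⊕ : ∀ l₁ l₂ P Q {v u} → v ∈[ l₁ +ₚ P ] → u ∈[ l₂ +ₚ Q ] →
  v + u ∈[ l₁ + l₂ +ₚ P ⊕ Q ]
∈[+ₚ]-⊕ l₁ l₂ P Q (x , x∈ , refl) (y , y∈ , refl) =
  x ℕ.+ y , ∈ₚ-⊕ P Q x∈ y∈ , interchange l₁ (+ x) l₂ (+ y)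

∈[+ₚ]-⊕⁻ : ∀ l₁ l₂ P Q {z} → z ∈[ l₁ + l₂ +ₚ P ⊕ Q ] →
  ∃[ v ] ∃[ u ] (v ∈[ l₁ +ₚ P ] × u ∈[ l₂ +ₚ Q ] × z ≡ v + u)
∈[+ₚ]-⊕⁻ l₁ l₂ P Q (k , k∈ , refl) with ∈ₚ-⊕⁻ P Q k∈
... | x , y , x∈ , y∈ , refl =
  l₁ + + x , l₂ + + y , (x , x∈ , refl) , (y , y∈ , refl) ,
  sym (interchange l₁ (+ x) l₂ (+ y))

stepMin : NStep → ℤ
stepMin m1     = - + 1
stepMin z0     = + 0
stepMin p1     = + 1
stepMin m1z0   = - + 1
stepMin m1p1   = - + 1
stepMin z0p1   = + 0
stepMin m1z0p1 = - + 1

stepProfile : NStep → Profile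
stepProfile m1     = evens 0
stepProfile z0     = evens 0
stepProfile p1     = evens 0
stepProfile m1z0   = interval 0
stepProfile m1p1   = evens 1
stepProfile z0p1   = interval 0
stepProfile m1z0p1 = interval 1

stepSet⇒∈[+ₚ] : ∀ s {v} → v ∈ stepSet s → v ∈[ stepMin s +ₚ stepProfile s ]
stepSet⇒∈[+ₚ] m1     (here refl)                 = 0 , (0 , z≤n , refl) , refl
stepSet⇒∈[+ₚ] z0     (here refl)                 = 0 , (0 , z≤n , refl) , refl
stepSet⇒∈[+ₚ] p1     (here refl)                 = 0 , (0 , z≤n , refl) , refl
stepSet⇒∈[+ₚ] m1z0   (here refl)                 = 0 , z≤n , refl
stepSet⇒∈[+ₚ] m1z0   (there (here refl))         = 1 , s≤s z≤n , refl
stepSet⇒∈[+ₚ] m1p1   (here refl)                 = 0 , (0 , z≤n , refl) , refl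
stepSet⇒∈[+ₚ] m1p1   (there (here refl))         = 2 , (1 , s≤s z≤n , refl) , refl
stepSet⇒∈[+ₚ] z0p1   (here refl)                 = 0 , z≤n , refl
stepSet⇒∈[+ₚ] z0p1   (there (here refl))         = 1 , s≤s z≤n , refl
stepSet⇒∈[+ₚ] m1z0p1 (here refl)                 = 0 , z≤n , refl
stepSet⇒∈[+ₚ] m1z0p1 (there (here refl))         = 1 , s≤s z≤n , refl
stepSet⇒∈[+ₚ] m1z0p1 (there (there (here refl))) = 2 , s≤s (s≤s z≤n) , refl

∈[+ₚ]⇒stepSet : ∀ s {v} → v ∈[ stepMin s +ₚ stepProfile s ] → v ∈ stepSet s
∈[+ₚ]⇒stepSet m1     (_ , (0 , _ , refl) , refl)            = here refl
∈[+ₚ]⇒stepSet z0     (_ , (0 , _ , refl) , refl)            = here refl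
∈[+ₚ]⇒stepSet p1     (_ , (0 , _ , refl) , refl)            = here refl
∈[+ₚ]⇒stepSet m1p1   (_ , (0 , _ , refl) , refl)            = here refl
∈[+ₚ]⇒stepSet m1p1   (_ , (1 , _ , refl) , refl)            = there (here refl)
∈[+ₚ]⇒stepSet m1p1   (_ , (suc (suc _) , s≤s () , _) , _)
∈[+ₚ]⇒stepSet m1z0   (0 , _ , refl)                         = here refl
∈[+ₚ]⇒stepSet m1z0   (1 , _ , refl)                         = there (here refl)
∈[+ₚ]⇒stepSet m1z0   (suc (suc _) , s≤s () , _)
∈[+ₚ]⇒stepSet z0p1   (0 , _ , refl)                         = here refl
∈[+ₚ]⇒stepSet z0p1   (1 , _ , refl)                         = there (here refl)
∈[+ₚ]⇒stepSet z0p1   (suc (suc _) , s≤s () , _)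
∈[+ₚ]⇒stepSet m1z0p1 (0 , _ , refl)                         = here refl
∈[+ₚ]⇒stepSet m1z0p1 (1 , _ , refl)                         = there (here refl)
∈[+ₚ]⇒stepSet m1z0p1 (2 , _ , refl)                         = there (there (here refl))
∈[+ₚ]⇒stepSet m1z0p1 (suc (suc (suc _)) , s≤s (s≤s ()) , _)

walkMin : Walk → ℤ
walkMin []      = + 0
walkMin (s ∷ w) = stepMin s + walkMin w

walkProfile : Walk → Profile
walkProfile []      = evens 0
walkProfile (s ∷ w) = stepProfile s ⊕ walkProfile w

record ReachSetIs (w : Walk) (lo : ℤ) (P : Profile) : Set where
  field reach⇔ : ∀ z → Reach w z ⇔ z ∈[ lo +ₚ P ]

open ReachSetIs

reachSet : ∀ w → ReachSetIs w (walkMin w) (walkProfile w)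
reachSet w .reach⇔ z = mk⇔ (reach⇒∈ w) (∈⇒reach w)
  where
  reach⇒∈ : ∀ w {z} → Reach w z → z ∈[ walkMin w +ₚ walkProfile w ]
  reach⇒∈ []      reach-[]       = 0 , (0 , z≤n , refl) , refl
  reach⇒∈ (s ∷ w) (reach-∷ v∈ r) =
    ∈[+ₚ]-⊕ (stepMin s) (walkMin w) (stepProfile s) (walkProfile w)
      (stepSet⇒∈[+ₚ] s v∈) (reach⇒∈ w r)

  ∈⇒reach : ∀ w {z} → z ∈[ walkMin w +ₚ walkProfile w ] → Reach w z
  ∈⇒reach []      (_ , (0 , _ , refl) , refl) = reach-[]
  ∈⇒reach (s ∷ w) z∈
    with ∈[+ₚ]-⊕⁻ (stepMin s) (walkMin w) (stepProfile s) (walkProfile w) z∈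
  ... | _ , _ , v∈ , u∈ , refl = reach-∷ (∈[+ₚ]⇒stepSet s v∈) (∈⇒reach w u∈)

IsEvens : Profile → Set
IsEvens (evens _)    = ⊤
IsEvens (interval _) = ⊥

IsEvens-⊕ : ∀ P Q → IsEvens (P ⊕ Q) ⇔ (IsEvens P × IsEvens Q)
IsEvens-⊕ (evens _)    (evens _)    = mk⇔ (λ _ → tt , tt) (λ _ → tt)
IsEvens-⊕ (evens _)    (interval _) = mk⇔ (λ ()) (λ ())
IsEvens-⊕ (interval _) (evens _)    = mk⇔ (λ ()) (λ ())
IsEvens-⊕ (interval _) (interval _) = mk⇔ (λ ()) (λ ())

IsEvens-stepProfile : ∀ s → IsEvens (stepProfile s) ⇔ s ∈ typeIISteps
IsEvens-stepProfile m1     = mk⇔ (λ _ → here refl) _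
IsEvens-stepProfile z0     = mk⇔ (λ _ → there (here refl)) _
IsEvens-stepProfile p1     = mk⇔ (λ _ → there (there (here refl))) _
IsEvens-stepProfile m1p1   = mk⇔ (λ _ → there (there (there (here refl)))) _
IsEvens-stepProfile m1z0   = mk⇔ (λ ()) (λ { (there (there (there (there ())))) })
IsEvens-stepProfile z0p1   = mk⇔ (λ ()) (λ { (there (there (there (there ())))) })
IsEvens-stepProfile m1z0p1 = mk⇔ (λ ()) (λ { (there (there (there (there ())))) })

IsEvens-walkProfile : ∀ w → IsEvens (walkProfile w) ⇔ All (_∈ typeIISteps) w
IsEvens-walkProfile []      = mk⇔ (const []) (const tt)
IsEvens-walkProfile (s ∷ w) = mk⇔ ⇒ ⇐
  where
  ⊕-split : IsEvens (walkProfile (s ∷ w)) ⇔ (IsEvens (stepProfile s) × IsEvens (walkProfile w))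
  ⊕-split = IsEvens-⊕ (stepProfile s) (walkProfile w)

  ⇒ : IsEvens (walkProfile (s ∷ w)) → All (_∈ typeIISteps) (s ∷ w)
  ⇒ e with to ⊕-split e
  ... | e₁ , e₂ = to (IsEvens-stepProfile s) e₁ ∷ to (IsEvens-walkProfile w) e₂

  ⇐ : All (_∈ typeIISteps) (s ∷ w) → IsEvens (walkProfile (s ∷ w))
  ⇐ (p ∷ ps) = from ⊕-split (from (IsEvens-stepProfile s) p , from (IsEvens-walkProfile w) ps)

lo+n-lo≡n : ∀ lo n → lo + + n - lo ≡ + n
lo+n-lo≡n lo n = xyx⁻¹≈y lo (+ n)

module _ {w lo P} (R : ReachSetIs w lo P) where

  reach-lo : Reach w lo
  reach-lo = from (reach⇔ R lo) (0 , 0∈ₚ P , sym (ℤ.+-identityʳ lo))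

  reach-top : Reach w (lo + + top P)
  reach-top = from (reach⇔ R _) (top P , top∈ₚ P , refl)

  isMin : IsMin w lo
  isMin = reach-lo , λ z r → lo≤ (to (reach⇔ R z) r)
    where
    lo≤ : ∀ {z} → z ∈[ lo +ₚ P ] → lo ≤ z
    lo≤ (x , _ , refl) = ℤ.i≤i+j lo (+ x)

  isMax : IsMax w (lo + + top P)
  isMax = reach-top , λ z r → ≤top (to (reach⇔ R z) r)
    where
    ≤top : ∀ {z} → z ∈[ lo +ₚ P ] → z ≤ lo + + top P
    ≤top (x , x∈ , refl) = ℤ.+-monoʳ-≤ lo (+≤+ (∈ₚ⇒≤top P x∈))

  extent : ∣ lo + + top P - lo ∣ ≡ top P
  extent = cong ∣_∣ (lo+n-lo≡n lo (top P))

IsMin-unique : ∀ {w m m′} → IsMin w m → IsMin w m′ → m ≡ m′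
IsMin-unique (r , m≤) (r′ , m′≤) = ℤ.≤-antisym (m≤ _ r′) (m′≤ _ r)

evens⇒TypeII : ∀ {w lo h} → ReachSetIs w lo (evens h) → TypeII w
evens⇒TypeII {lo = lo} {h} R =
  lo , lo + + top (evens h) , isMin R , isMax R ,
  λ z → mk⇔ (⇒ ∘ to (reach⇔ R z)) (from (reach⇔ R z) ∘ ⇐)
  where
  half-extent : ∣ lo + + top (evens h) - lo ∣ ℕ./ 2 ≡ h
  half-extent = trans (cong (ℕ._/ 2) (trans (extent R) (ℕ.*-comm 2 h))) (m*n/n≡m h 2)

  ⇒ : ∀ {z} → z ∈[ lo +ₚ evens h ] →
    ∃[ i ] (i ℕ.≤ ∣ lo + + top (evens h) - lo ∣ ℕ./ 2 × z ≡ lo + + (2 ℕ.* i))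
  ⇒ (_ , (i , i≤h , refl) , refl) = i , subst (i ℕ.≤_) (sym half-extent) i≤h , refl

  ⇐ : ∀ {z} →
    ∃[ i ] (i ℕ.≤ ∣ lo + + top (evens h) - lo ∣ ℕ./ 2 × z ≡ lo + + (2 ℕ.* i)) →
    z ∈[ lo +ₚ evens h ]
  ⇐ (i , i≤ , refl) = 2 ℕ.* i , (i , subst (i ℕ.≤_) half-extent i≤ , refl) , refl

interval⇒TypeI : ∀ {w lo n} → ReachSetIs w lo (interval n) → TypeI w
interval⇒TypeI {lo = lo} {n} R =
  lo , lo + + suc n , isMin R , isMax R ,
  (λ z → mk⇔ (⇒ ∘ to (reach⇔ R z)) (from (reach⇔ R z) ∘ ⇐)) ,
  subst (+ 1 ≤_) (sym (lo+n-lo≡n lo (suc n))) (+≤+ (s≤s z≤n))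
  where
  ⇒ : ∀ {z} → z ∈[ lo +ₚ interval n ] →
    ∃[ i ] (i ℕ.≤ ∣ lo + + suc n - lo ∣ × z ≡ lo + + i)
  ⇒ (x , x≤ , refl) = x , subst (x ℕ.≤_) (sym (extent R)) x≤ , refl

  ⇐ : ∀ {z} → ∃[ i ] (i ℕ.≤ ∣ lo + + suc n - lo ∣ × z ≡ lo + + i) →
    z ∈[ lo +ₚ interval n ]
  ⇐ (i , i≤ , refl) = i , subst (i ℕ.≤_) (extent R) i≤ , refl

-- lo + 1 is reachable, but a type II walk only reaches points of the parity of its minimum lo.
interval⇒¬TypeII : ∀ {w lo n} → ReachSetIs w lo (interval n) → ¬ TypeII w
interval⇒¬TypeII {lo = lo} R (m , _ , m-min , _ , R₂)
  with to (R₂ (lo + + 1)) (from (reach⇔ R (lo + + 1)) (1 , s≤s z≤n , refl))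
... | i , _ , lo+1≡m+2i =
  2*i≢1 i (sym (ℤ.+-injective (∙-cancelˡ lo (+ 1) (+ (2 ℕ.* i)) lo+1≡lo+2i)))
  where
  lo+1≡lo+2i : lo + + 1 ≡ lo + + (2 ℕ.* i)
  lo+1≡lo+2i = trans lo+1≡m+2i (cong (_+ + (2 ℕ.* i)) (IsMin-unique m-min (isMin R)))

proposition3p2 : (w : Walk) →
    (TypeII w ⇔ All (λ s → s ∈ typeIISteps) w) ×
    (¬ All (λ s → s ∈ typeIISteps) w → TypeI w)
proposition3p2 w = classify (walkProfile w) (reachSet w) (IsEvens-walkProfile w)
  where
  classify : ∀ P → ReachSetIs w (walkMin w) P → IsEvens P ⇔ All (_∈ typeIISteps) w →
    (TypeII w ⇔ All (_∈ typeIISteps) w) × (¬ All (_∈ typeIISteps) w → TypeI w)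
  classify (evens h) R E =
    mk⇔ (const (to E tt)) (const (evens⇒TypeII R)) , contradiction (to E tt)
  classify (interval n) R E =
    mk⇔ (⊥-elim ∘ interval⇒¬TypeII R) (⊥-elim ∘ from E) , const (interval⇒TypeI R)
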